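{- Let $r\geq 1$ be an integer, let $G$ be a hypergraph all of whose edges have size at most $r+1$, and let $\ell$ be a positive integer. Then there is a partition $V_1\cup\dots\cup V_\ell$ of $V(G)$ such that for every $i$ and every vertex $x\in V_i$, the number of edges of $G$ containing $x$ and at least one other vertex of $V_i$ is at most $r\deg(x)/\ell$.
   Context: A hypergraph $G$ has a finite vertex set $V(G)$ and edge set $E(G)\subseteq 2^{V(G)}$. $\deg(x)$ denotes the number of edges containing $x$. Parts of the partition may be empty. -}

module Defs where

open import Data.Nat using (ℕ; suc; _≤_)
open import Data.Fin using (Fin; _≟_)
open import Data.Fin.Subset using (Subset; _∈_; ∣_∣)
open import Data.Fin.Subset.Properties using (_∈?_)
open import Data.Fin.Properties using (any?)
open import Data.List using (List; length; filter)
open import Data.List.Relation.Unary.All using (All)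
open import Data.List.Relation.Unary.Unique.Propositional using (Unique)
open import Data.Product using (_×_; ∃)
open import Relation.Binary.PropositionalEquality using (_≡_; _≢_)
open import Relation.Nullary using (¬_)
open import Relation.Nullary.Decidable using (_×-dec_; ¬?)

-- A hypergraph on vertex set Fin n: a duplicate-free list of edges,
-- each edge a subset of the vertex set (so E(G) ⊆ 2^V(G) is a set).
record Hypergraph : Set where
  field
    n      : ℕ
    edges  : List (Subset n)
    unique : Unique edges

open Hypergraph public

EdgesAtMost : ℕ → Hypergraph → Set
EdgesAtMost k G = All (λ e → ∣ e ∣ ≤ k) (edges G)

deg : (G : Hypergraph) → Fin (n G) → ℕ
deg G x = length (filter (x ∈?_) (edges G))

-- A partition V_1 ∪ ... ∪ V_ℓ of V(G) (parts may be empty) is a map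
-- assigning each vertex its part.
Partition : Hypergraph → ℕ → Set
Partition G ℓ = Fin (n G) → Fin ℓ

sameDeg : (G : Hypergraph) {ℓ : ℕ} → Partition G ℓ → Fin (n G) → ℕ
sameDeg G p x =
  length (filter (λ e → (x ∈? e) ×-dec
                        any? (λ y → ¬? (y ≟ x) ×-dec ((y ∈? e) ×-dec (p y ≟ p x))))
                 (edges G))

{-# OPTIONS --safe #-}
-- Colour the vertices with ℓ colours and take as potential the number of pairs (e, k) such that
-- the edge e meets colour class k. Recolouring x from i to j raises the potential by
-- degIn x i − degIn x j, where degIn x k counts the edges through x meeting class k in a vertex
-- other than x. The potential is at most |E| ℓ, so hill climbing reaches a colouring c with
-- degIn x (c x) ≤ degIn x k for all x and k. Summing over k gives ℓ · sameDeg x ≤ ∑ₖ degIn x k,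
-- and an edge e ∋ x contributes to at most |e| − 1 ≤ r of these terms, whence r · deg x.
module Submission where

open import Defs
open import Level using (Level)
open import Algebra.Properties.CommutativeSemigroup using (x∙yz≈y∙xz)
open import Data.Bool using (true; false; if_then_else_)
open import Data.Empty using (⊥-elim)
open import Data.Fin using (Fin; zero; suc; _≟_)
open import Data.Fin.Properties using (any?; all?; ¬∀⟶∃¬)
open import Data.Fin.Subset using (Subset; _∈_; _∉_; ∣_∣; inside; outside)
open import Data.Fin.Subset.Properties using (_∈?_)
open import Data.List using (List; []; _∷_; length; filter; lookup)
open import Data.List.Membership.Propositional.Properties using (∈-lookup)
import Data.List.Relation.Unary.All as All
open import Data.Nat using (ℕ; zero; suc; _+_; _*_; _∸_; _≤_; _<_; z≤n; _≤?_)
open import Data.Nat.Properties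
  using (+-*-semiring; +-commutativeSemigroup; +-comm; *-identityˡ; *-identityʳ; *-comm;
         +-mono-≤; *-monoʳ-≤; +-monoʳ-<; +-cancelʳ-<; ∸-monoʳ-<; ≤-refl; ≤-reflexive; ≤-trans;
         <-≤-trans; ≤-pred; m≤m+n; n<1+n; ≰⇒>; module ≤-Reasoning)
open import Algebra.Properties.Semiring.Sum +-*-semiring
  using (sum-syntax; sum-cong-≗; sum-replicate-zero; ∑-comm; ∑-distrib-+; *-distribˡ-sum; *-distribʳ-sum)
open import Data.Product using (Σ; ∃; _×_; _,_)
open import Data.Sum using (_⊎_; inj₁; inj₂)
open import Data.Vec using ([]; _∷_)
open import Data.Vec.Functional using (updateAt)
open import Data.Vec.Functional.Properties using (updateAt-updates; updateAt-minimal)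
open import Function using (_∘_; const)
open import Relation.Binary.PropositionalEquality
  using (_≡_; _≢_; refl; sym; trans; cong; cong₂; module ≡-Reasoning)
open import Relation.Nullary using (¬_; Dec; yes; no; does)
open import Relation.Nullary.Decidable using (_×-dec_; _⊎-dec_; ¬?)

private
  variable
    a b : Level
    A B : Set a
    N ℓ : ℕ

𝟙 : Dec A → ℕ
𝟙 a? = if does a? then 1 else 0

𝟙-yes : (a? : Dec A) → A → 𝟙 a? ≡ 1
𝟙-yes (yes _) _ = refl
𝟙-yes (no ¬a) a = ⊥-elim (¬a a)

𝟙-no : (a? : Dec A) → ¬ A → 𝟙 a? ≡ 0
𝟙-no (yes a) ¬a = ⊥-elim (¬a a)
𝟙-no (no _)  _  = refl

𝟙-cong : (a? : Dec A) (b? : Dec B) → (A → B) → (B → A) → 𝟙 a? ≡ 𝟙 b?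
𝟙-cong (yes a) b? f g = sym (𝟙-yes b? (f a))
𝟙-cong (no ¬a) b? f g = sym (𝟙-no b? (¬a ∘ g))

𝟙≤1 : (a? : Dec A) → 𝟙 a? ≤ 1
𝟙≤1 (yes _) = ≤-refl
𝟙≤1 (no _)  = z≤n

𝟙-× : (a? : Dec A) (b? : Dec B) → 𝟙 (a? ×-dec b?) ≡ 𝟙 a? * 𝟙 b?
𝟙-× (yes _) b? = sym (*-identityˡ (𝟙 b?))
𝟙-× (no _)  b? = refl

∑-mono-≤ : {f g : Fin N → ℕ} → (∀ k → f k ≤ g k) → ∑[ k < N ] f k ≤ ∑[ k < N ] g k
∑-mono-≤ {zero}  _   = z≤n
∑-mono-≤ {suc N} f≤g = +-mono-≤ (f≤g zero) (∑-mono-≤ (f≤g ∘ suc))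

∑-const : ∀ N c → ∑[ k < N ] c ≡ N * c
∑-const zero    c = refl
∑-const (suc N) c = cong (c +_) (∑-const N c)

∑-remove : (i : Fin N) (f : Fin N → ℕ) → ∑[ k < N ] f k ≡ f i + ∑[ k < N ] (𝟙 (¬? (k ≟ i)) * f k)
∑-remove {suc N} zero    f = cong (f zero +_) (sum-cong-≗ (λ k → sym (*-identityˡ (f (suc k)))))
∑-remove {suc N} (suc i) f = begin
  f zero + ∑[ k < N ] f (suc k)     ≡⟨ cong (f zero +_) (∑-remove i (f ∘ suc)) ⟩
  f zero + (f (suc i) + rest)       ≡⟨ x∙yz≈y∙xz +-commutativeSemigroup (f zero) (f (suc i)) rest ⟩
  f (suc i) + (f zero + rest)       ≡⟨ cong (λ t → f (suc i) + (t + rest)) (sym (*-identityˡ (f zero))) ⟩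
  f (suc i) + (1 * f zero + rest)   ∎
  where
  open ≡-Reasoning
  rest = ∑[ k < N ] (𝟙 (¬? (k ≟ i)) * f (suc k))

∑-𝟙≡ : (i : Fin N) → ∑[ k < N ] 𝟙 (i ≟ k) ≡ 1
∑-𝟙≡ {N} i = begin
  ∑[ k < N ] 𝟙 (i ≟ k)
    ≡⟨ ∑-remove i (λ k → 𝟙 (i ≟ k)) ⟩
  𝟙 (i ≟ i) + ∑[ k < N ] (𝟙 (¬? (k ≟ i)) * 𝟙 (i ≟ k))
    ≡⟨ cong₂ _+_ (𝟙-yes (i ≟ i) refl) (sum-cong-≗ off-diagonal) ⟩
  1 + ∑[ k < N ] 0
    ≡⟨ cong (1 +_) (sum-replicate-zero N) ⟩
  1 ∎
  where
  open ≡-Reasoning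
  off-diagonal : ∀ k → 𝟙 (¬? (k ≟ i)) * 𝟙 (i ≟ k) ≡ 0
  off-diagonal k with k ≟ i
  ... | yes _   = refl
  ... | no  k≢i = cong (1 *_) (𝟙-no (i ≟ k) (k≢i ∘ sym))

∑-𝟙-insert : {Q : Fin N → Set b} (i : Fin N) (Q? : ∀ k → Dec (Q k)) →
             ∑[ k < N ] 𝟙 ((i ≟ k) ⊎-dec Q? k) + 𝟙 (Q? i) ≡ ∑[ k < N ] 𝟙 (Q? k) + 1
∑-𝟙-insert {N} i Q? = begin
  ∑[ k < N ] 𝟙 ((i ≟ k) ⊎-dec Q? k) + 𝟙 (Q? i)  ≡⟨ cong (_+ 𝟙 (Q? i)) (∑-remove i _) ⟩
  𝟙 ((i ≟ i) ⊎-dec Q? i) + rest′ + 𝟙 (Q? i)     ≡⟨ cong₂ (λ s t → s + t + 𝟙 (Q? i))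
                                                          (𝟙-yes ((i ≟ i) ⊎-dec Q? i) (inj₁ refl))
                                                          (sum-cong-≗ off-i) ⟩
  suc (rest + 𝟙 (Q? i))                          ≡⟨ cong suc (+-comm rest (𝟙 (Q? i))) ⟩
  suc (𝟙 (Q? i) + rest)                          ≡⟨ +-comm 1 _ ⟩
  𝟙 (Q? i) + rest + 1                            ≡⟨ cong (_+ 1) (∑-remove i (𝟙 ∘ Q?)) ⟨
  ∑[ k < N ] 𝟙 (Q? k) + 1                        ∎
  where
  open ≡-Reasoning
  rest′ = ∑[ k < N ] (𝟙 (¬? (k ≟ i)) * 𝟙 ((i ≟ k) ⊎-dec Q? k))
  rest  = ∑[ k < N ] (𝟙 (¬? (k ≟ i)) * 𝟙 (Q? k))
  off-i : ∀ k → 𝟙 (¬? (k ≟ i)) * 𝟙 ((i ≟ k) ⊎-dec Q? k) ≡ 𝟙 (¬? (k ≟ i)) * 𝟙 (Q? k)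
  off-i k with k ≟ i
  ... | yes _   = refl
  ... | no  k≢i = cong (1 *_) (𝟙-cong ((i ≟ k) ⊎-dec Q? k) (Q? k)
                                 (λ { (inj₁ i≡k) → ⊥-elim (k≢i (sym i≡k)) ; (inj₂ q) → q }) inj₂)

∑-𝟙-×-dec : {Q : Fin N → Set b} (a? : Dec A) (Q? : ∀ k → Dec (Q k)) →
             ∑[ k < N ] 𝟙 (a? ×-dec Q? k) ≡ 𝟙 a? * ∑[ k < N ] 𝟙 (Q? k)
∑-𝟙-×-dec a? Q? = trans (sum-cong-≗ (λ k → 𝟙-× a? (Q? k))) (sym (*-distribˡ-sum (𝟙 a?) (𝟙 ∘ Q?)))

𝟙-any?≤∑ : {P : Fin N → Set b} (P? : ∀ y → Dec (P y)) → 𝟙 (any? P?) ≤ ∑[ y < N ] 𝟙 (P? y)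
𝟙-any?≤∑ {N} P? with any? P?
... | no  _        = z≤n
... | yes (y , py) = begin
  1                                               ≡⟨ 𝟙-yes (P? y) py ⟨
  𝟙 (P? y)                                        ≤⟨ m≤m+n _ _ ⟩
  𝟙 (P? y) + ∑[ k < N ] (𝟙 (¬? (k ≟ y)) * 𝟙 (P? k)) ≡⟨ ∑-remove y (𝟙 ∘ P?) ⟨
  ∑[ k < N ] 𝟙 (P? k)                             ∎
  where open ≤-Reasoning

∣p∣≡∑𝟙∈ : (p : Subset N) → ∣ p ∣ ≡ ∑[ y < N ] 𝟙 (y ∈? p)
∣p∣≡∑𝟙∈ []            = refl
∣p∣≡∑𝟙∈ (inside  ∷ p) = cong suc (∣p∣≡∑𝟙∈ p)
∣p∣≡∑𝟙∈ (outside ∷ p) = ∣p∣≡∑𝟙∈ p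

length-filter≡∑ : {P : A → Set b} (P? : ∀ x → Dec (P x)) (xs : List A) →
                  length (filter P? xs) ≡ ∑[ t < length xs ] 𝟙 (P? (lookup xs t))
length-filter≡∑ P? []       = refl
length-filter≡∑ P? (x ∷ xs) with does (P? x)
... | true  = cong suc (length-filter≡∑ P? xs)
... | false = length-filter≡∑ P? xs

∑-𝟙-any?≤ : {P : Fin N → Fin ℓ → Set b} (P? : ∀ y k → Dec (P y k)) →
            ∑[ k < ℓ ] 𝟙 (any? λ y → P? y k) ≤ ∑[ y < N ] ∑[ k < ℓ ] 𝟙 (P? y k)
∑-𝟙-any?≤ {N} {ℓ} P? = begin
  ∑[ k < ℓ ] 𝟙 (any? λ y → P? y k)      ≤⟨ ∑-mono-≤ (λ k → 𝟙-any?≤∑ (λ y → P? y k)) ⟩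
  ∑[ k < ℓ ] ∑[ y < N ] 𝟙 (P? y k)      ≡⟨ ∑-comm (λ k y → 𝟙 (P? y k)) ⟩
  ∑[ y < N ] ∑[ k < ℓ ] 𝟙 (P? y k)      ∎
  where open ≤-Reasoning

meets? : (c : Fin N → Fin ℓ) (e : Subset N) (k : Fin ℓ) → Dec (∃ λ y → y ∈ e × c y ≡ k)
meets? c e k = any? λ y → (y ∈? e) ×-dec (c y ≟ k)

colours : (c : Fin N → Fin ℓ) → Subset N → ℕ
colours {ℓ = ℓ} c e = ∑[ k < ℓ ] 𝟙 (meets? c e k)

meetsOthers? : (c : Fin N → Fin ℓ) (x : Fin N) (e : Subset N) (k : Fin ℓ) →
               Dec (∃ λ y → y ≢ x × y ∈ e × c y ≡ k)
meetsOthers? c x e k = any? λ y → ¬? (y ≟ x) ×-dec ((y ∈? e) ×-dec (c y ≟ k))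

coloursBesides : (c : Fin N → Fin ℓ) → Fin N → Subset N → ℕ
coloursBesides {ℓ = ℓ} c x e = ∑[ k < ℓ ] 𝟙 (meetsOthers? c x e k)

colours≤ : (c : Fin N → Fin ℓ) (e : Subset N) → colours c e ≤ ℓ
colours≤ {ℓ = ℓ} c e = begin
  colours c e    ≤⟨ ∑-mono-≤ (λ k → 𝟙≤1 (meets? c e k)) ⟩
  ∑[ k < ℓ ] 1   ≡⟨ ∑-const ℓ 1 ⟩
  ℓ * 1          ≡⟨ *-identityʳ ℓ ⟩
  ℓ              ∎
  where open ≤-Reasoning

coloursBesides<∣e∣ : (c : Fin N → Fin ℓ) {x : Fin N} {e : Subset N} → x ∈ e → coloursBesides c x e < ∣ e ∣
coloursBesides<∣e∣ {N} {ℓ} c {x} {e} x∈e = begin-strict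
  coloursBesides c x e       ≤⟨ ∑-𝟙-any?≤ (λ y k → ¬? (y ≟ x) ×-dec ((y ∈? e) ×-dec (c y ≟ k))) ⟩
  ∑[ y < N ] ∑[ k < ℓ ] 𝟙 (¬? (y ≟ x) ×-dec ((y ∈? e) ×-dec (c y ≟ k)))
                             ≡⟨ sum-cong-≗ one-colour-each ⟩
  others                     <⟨ n<1+n others ⟩
  1 + others                 ≡⟨ cong (_+ others) (𝟙-yes (x ∈? e) x∈e) ⟨
  𝟙 (x ∈? e) + others        ≡⟨ ∑-remove x (λ y → 𝟙 (y ∈? e)) ⟨
  ∑[ y < N ] 𝟙 (y ∈? e)      ≡⟨ ∣p∣≡∑𝟙∈ e ⟨
  ∣ e ∣                      ∎
  where
  open ≤-Reasoning
  others = ∑[ y < N ] (𝟙 (¬? (y ≟ x)) * 𝟙 (y ∈? e))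
  one-colour-each : ∀ y → ∑[ k < ℓ ] 𝟙 (¬? (y ≟ x) ×-dec ((y ∈? e) ×-dec (c y ≟ k)))
                          ≡ 𝟙 (¬? (y ≟ x)) * 𝟙 (y ∈? e)
  one-colour-each y = begin-equality
    ∑[ k < ℓ ] 𝟙 (¬? (y ≟ x) ×-dec ((y ∈? e) ×-dec (c y ≟ k)))
      ≡⟨ ∑-𝟙-×-dec (¬? (y ≟ x)) (λ k → (y ∈? e) ×-dec (c y ≟ k)) ⟩
    𝟙 (¬? (y ≟ x)) * ∑[ k < ℓ ] 𝟙 ((y ∈? e) ×-dec (c y ≟ k))
      ≡⟨ cong (𝟙 (¬? (y ≟ x)) *_) (∑-𝟙-×-dec (y ∈? e) (c y ≟_)) ⟩
    𝟙 (¬? (y ≟ x)) * (𝟙 (y ∈? e) * ∑[ k < ℓ ] 𝟙 (c y ≟ k))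
      ≡⟨ cong (λ s → 𝟙 (¬? (y ≟ x)) * (𝟙 (y ∈? e) * s)) (∑-𝟙≡ (c y)) ⟩
    𝟙 (¬? (y ≟ x)) * (𝟙 (y ∈? e) * 1)
      ≡⟨ cong (𝟙 (¬? (y ≟ x)) *_) (*-identityʳ (𝟙 (y ∈? e))) ⟩
    𝟙 (¬? (y ≟ x)) * 𝟙 (y ∈? e) ∎

colours+𝟙≡coloursBesides+1 : (c : Fin N → Fin ℓ) {x : Fin N} {e : Subset N} → x ∈ e →
                             colours c e + 𝟙 (meetsOthers? c x e (c x)) ≡ coloursBesides c x e + 1
colours+𝟙≡coloursBesides+1 {ℓ = ℓ} c {x} {e} x∈e = begin
  colours c e + 𝟙 (meetsOthers? c x e (c x))
    ≡⟨ cong (_+ 𝟙 (meetsOthers? c x e (c x))) (sum-cong-≗ meets-via-x) ⟩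
  ∑[ k < ℓ ] 𝟙 ((c x ≟ k) ⊎-dec meetsOthers? c x e k) + 𝟙 (meetsOthers? c x e (c x))
    ≡⟨ ∑-𝟙-insert (c x) (meetsOthers? c x e) ⟩
  coloursBesides c x e + 1 ∎
  where
  open ≡-Reasoning
  meets-via-x : ∀ k → 𝟙 (meets? c e k) ≡ 𝟙 ((c x ≟ k) ⊎-dec meetsOthers? c x e k)
  meets-via-x k = 𝟙-cong (meets? c e k) ((c x ≟ k) ⊎-dec meetsOthers? c x e k) split merge
    where
    split : ∃ (λ y → y ∈ e × c y ≡ k) → c x ≡ k ⊎ ∃ λ y → y ≢ x × y ∈ e × c y ≡ k
    split (y , y∈e , cy≡k) with y ≟ x
    ... | yes refl = inj₁ cy≡k
    ... | no  y≢x  = inj₂ (y , y≢x , y∈e , cy≡k)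
    merge : c x ≡ k ⊎ (∃ λ y → y ≢ x × y ∈ e × c y ≡ k) → ∃ λ y → y ∈ e × c y ≡ k
    merge (inj₁ cx≡k)                = x , x∈e , cx≡k
    merge (inj₂ (y , _ , y∈e , cy≡k)) = y , y∈e , cy≡k

meetsOthers-updateAt : (c : Fin N → Fin ℓ) (x : Fin N) (j : Fin ℓ) (e : Subset N) (k : Fin ℓ) →
                       𝟙 (meetsOthers? (updateAt c x (const j)) x e k) ≡ 𝟙 (meetsOthers? c x e k)
meetsOthers-updateAt c x j e k = 𝟙-cong (meetsOthers? (updateAt c x (const j)) x e k) (meetsOthers? c x e k)
  (λ { (y , y≢x , y∈e , c′y≡k) → y , y≢x , y∈e , trans (sym (updateAt-minimal y x c y≢x)) c′y≡k })
  (λ { (y , y≢x , y∈e , cy≡k)  → y , y≢x , y∈e , trans (updateAt-minimal y x c y≢x) cy≡k })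

colours-updateAt-∉ : (c : Fin N → Fin ℓ) {x : Fin N} (j : Fin ℓ) {e : Subset N} → x ∉ e →
                     colours (updateAt c x (const j)) e ≡ colours c e
colours-updateAt-∉ c {x} j {e} x∉e = sum-cong-≗ λ k →
  𝟙-cong (meets? (updateAt c x (const j)) e k) (meets? c e k)
    (λ { (y , y∈e , c′y≡k) → y , y∈e , trans (sym (updateAt-minimal y x c (y≢x y∈e))) c′y≡k })
    (λ { (y , y∈e , cy≡k)  → y , y∈e , trans (updateAt-minimal y x c (y≢x y∈e)) cy≡k })
  where
  y≢x : ∀ {y} → y ∈ e → y ≢ x
  y≢x y∈e refl = x∉e y∈e

colours-updateAt-∈ : (c : Fin N → Fin ℓ) {x : Fin N} (j : Fin ℓ) {e : Subset N} → x ∈ e →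
                     colours (updateAt c x (const j)) e + 𝟙 (meetsOthers? c x e j)
                     ≡ colours c e + 𝟙 (meetsOthers? c x e (c x))
colours-updateAt-∈ {ℓ = ℓ} c {x} j {e} x∈e = begin
  colours c′ e + 𝟙 (meetsOthers? c x e j)        ≡⟨ cong (colours c′ e +_) (meetsOthers-updateAt c x j e j) ⟨
  colours c′ e + 𝟙 (meetsOthers? c′ x e j)       ≡⟨ cong (λ k → colours c′ e + 𝟙 (meetsOthers? c′ x e k))
                                                         (updateAt-updates x c) ⟨
  colours c′ e + 𝟙 (meetsOthers? c′ x e (c′ x))  ≡⟨ colours+𝟙≡coloursBesides+1 c′ x∈e ⟩
  coloursBesides c′ x e + 1                      ≡⟨ cong (_+ 1) (sum-cong-≗ (meetsOthers-updateAt c x j e)) ⟩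
  coloursBesides c x e + 1                       ≡⟨ colours+𝟙≡coloursBesides+1 c x∈e ⟨
  colours c e + 𝟙 (meetsOthers? c x e (c x))     ∎
  where
  open ≡-Reasoning
  c′ = updateAt c x (const j)

colours-updateAt : (c : Fin N → Fin ℓ) (x : Fin N) (j : Fin ℓ) (e : Subset N) →
                   colours (updateAt c x (const j)) e + 𝟙 (x ∈? e) * 𝟙 (meetsOthers? c x e j)
                   ≡ colours c e + 𝟙 (x ∈? e) * 𝟙 (meetsOthers? c x e (c x))
colours-updateAt c x j e with x ∈? e
... | yes x∈e = trans (cong (colours (updateAt c x (const j)) e +_) (*-identityˡ _))
                      (trans (colours-updateAt-∈ c j x∈e) (cong (colours c e +_) (sym (*-identityˡ _))))
... | no  x∉e = cong (_+ 0) (colours-updateAt-∉ c j x∉e)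

ascend : {P : A → Set b} (Φ : A → ℕ) (B : ℕ) → (∀ x → Φ x ≤ B) →
         (∀ x → P x ⊎ ∃ λ y → Φ x < Φ y) → A → ∃ P
ascend {P = P} Φ B Φ≤B improve x₀ = climb (suc (B ∸ Φ x₀)) x₀ (n<1+n _)
  where
  climb : ∀ fuel x → B ∸ Φ x < fuel → ∃ P
  climb (suc fuel) x gap<fuel with improve x
  ... | inj₁ px           = x , px
  ... | inj₂ (y , Φx<Φy) = climb fuel y (<-≤-trans (∸-monoʳ-< Φx<Φy (Φ≤B y)) (≤-pred gap<fuel))

module _ (G : Hypergraph) {ℓ : ℕ} where

  private
    E = edges G

  potential : Partition G ℓ → ℕ
  potential c = ∑[ t < length E ] colours c (lookup E t)

  -- sameDeg G c x is degIn c x (c x) by definition.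
  degIn : Partition G ℓ → Fin (n G) → Fin ℓ → ℕ
  degIn c x k = length (filter (λ e → (x ∈? e) ×-dec meetsOthers? c x e k) E)

  Stable : Partition G ℓ → Set
  Stable c = ∀ x k → degIn c x (c x) ≤ degIn c x k

  deg≡∑ : ∀ x → deg G x ≡ ∑[ t < length E ] 𝟙 (x ∈? lookup E t)
  deg≡∑ x = length-filter≡∑ (x ∈?_) E

  degIn≡∑ : ∀ c x k →
            degIn c x k ≡ ∑[ t < length E ] (𝟙 (x ∈? lookup E t) * 𝟙 (meetsOthers? c x (lookup E t) k))
  degIn≡∑ c x k = trans (length-filter≡∑ (λ e → (x ∈? e) ×-dec meetsOthers? c x e k) E)
                        (sum-cong-≗ λ t → 𝟙-× (x ∈? lookup E t) (meetsOthers? c x (lookup E t) k))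

  potential≤ : ∀ c → potential c ≤ length E * ℓ
  potential≤ c = ≤-trans (∑-mono-≤ λ t → colours≤ c (lookup E t)) (≤-reflexive (∑-const (length E) ℓ))

  potential-updateAt : ∀ c x j → potential (updateAt c x (const j)) + degIn c x j ≡ potential c + degIn c x (c x)
  potential-updateAt c x j = begin
    potential c′ + degIn c x j
      ≡⟨ cong (potential c′ +_) (degIn≡∑ c x j) ⟩
    potential c′ + ∑[ t < length E ] (𝟙 (x ∈? e t) * 𝟙 (meetsOthers? c x (e t) j))
      ≡⟨ ∑-distrib-+ (λ t → colours c′ (e t)) _ ⟨
    ∑[ t < length E ] (colours c′ (e t) + 𝟙 (x ∈? e t) * 𝟙 (meetsOthers? c x (e t) j))
      ≡⟨ sum-cong-≗ (λ t → colours-updateAt c x j (e t)) ⟩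
    ∑[ t < length E ] (colours c (e t) + 𝟙 (x ∈? e t) * 𝟙 (meetsOthers? c x (e t) (c x)))
      ≡⟨ ∑-distrib-+ (λ t → colours c (e t)) _ ⟩
    potential c + ∑[ t < length E ] (𝟙 (x ∈? e t) * 𝟙 (meetsOthers? c x (e t) (c x)))
      ≡⟨ cong (potential c +_) (degIn≡∑ c x (c x)) ⟨
    potential c + degIn c x (c x) ∎
    where
    open ≡-Reasoning
    c′ = updateAt c x (const j)
    e  = lookup E

  stable-or-improvable : ∀ c → Stable c ⊎ ∃ λ c′ → potential c < potential c′
  stable-or-improvable c with all? (λ x → all? λ k → degIn c x (c x) ≤? degIn c x k)
  ... | yes stable = inj₁ stable
  ... | no ¬stable with ¬∀⟶∃¬ _ _ (λ x → all? λ k → degIn c x (c x) ≤? degIn c x k) ¬stable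
  ...   | x , ¬stable-x with ¬∀⟶∃¬ _ _ (λ k → degIn c x (c x) ≤? degIn c x k) ¬stable-x
  ...     | j , cx≰j = inj₂ (updateAt c x (const j) , +-cancelʳ-< _ _ _ (begin-strict
    potential c + degIn c x j                               <⟨ +-monoʳ-< (potential c) (≰⇒> cx≰j) ⟩
    potential c + degIn c x (c x)                           ≡⟨ potential-updateAt c x j ⟨
    potential (updateAt c x (const j)) + degIn c x j        ∎))
    where open ≤-Reasoning

  ∑-degIn≤ : ∀ {r} → EdgesAtMost (suc r) G → ∀ c x → ∑[ k < ℓ ] degIn c x k ≤ r * deg G x
  ∑-degIn≤ {r} small c x = begin
    ∑[ k < ℓ ] degIn c x k
      ≡⟨ sum-cong-≗ (degIn≡∑ c x) ⟩
    ∑[ k < ℓ ] ∑[ t < length E ] (𝟙 (x ∈? e t) * 𝟙 (meetsOthers? c x (e t) k))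
      ≡⟨ ∑-comm (λ k t → 𝟙 (x ∈? e t) * 𝟙 (meetsOthers? c x (e t) k)) ⟩
    ∑[ t < length E ] ∑[ k < ℓ ] (𝟙 (x ∈? e t) * 𝟙 (meetsOthers? c x (e t) k))
      ≡⟨ sum-cong-≗ (λ t → *-distribˡ-sum (𝟙 (x ∈? e t)) (𝟙 ∘ meetsOthers? c x (e t))) ⟨
    ∑[ t < length E ] (𝟙 (x ∈? e t) * coloursBesides c x (e t))
      ≤⟨ ∑-mono-≤ per-edge ⟩
    ∑[ t < length E ] (𝟙 (x ∈? e t) * r)
      ≡⟨ *-distribʳ-sum r (λ t → 𝟙 (x ∈? e t)) ⟨
    (∑[ t < length E ] 𝟙 (x ∈? e t)) * r
      ≡⟨ cong (_* r) (deg≡∑ x) ⟨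
    deg G x * r
      ≡⟨ *-comm (deg G x) r ⟩
    r * deg G x ∎
    where
    open ≤-Reasoning
    e = lookup E
    per-edge : ∀ t → 𝟙 (x ∈? e t) * coloursBesides c x (e t) ≤ 𝟙 (x ∈? e t) * r
    per-edge t with x ∈? e t
    ... | yes x∈e = *-monoʳ-≤ 1 (≤-pred (<-≤-trans (coloursBesides<∣e∣ c x∈e)
                                                  (All.lookup small (∈-lookup t))))
    ... | no  _   = z≤n

  stable⇒sameDeg≤ : ∀ {r} → EdgesAtMost (suc r) G → ∀ c → Stable c → ∀ x → ℓ * sameDeg G c x ≤ r * deg G x
  stable⇒sameDeg≤ {r} small c stable x = begin
    ℓ * degIn c x (c x)              ≡⟨ ∑-const ℓ (degIn c x (c x)) ⟨
    ∑[ k < ℓ ] degIn c x (c x)       ≤⟨ ∑-mono-≤ (stable x) ⟩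
    ∑[ k < ℓ ] degIn c x k           ≤⟨ ∑-degIn≤ small c x ⟩
    r * deg G x                      ∎
    where open ≤-Reasoning

lemma12 : (r : ℕ) → 1 ≤ r → (G : Hypergraph) → EdgesAtMost (suc r) G →
          (ℓ : ℕ) → 1 ≤ ℓ →
          Σ (Partition G ℓ) (λ p → ∀ x → ℓ * sameDeg G p x ≤ r * deg G x)
lemma12 r _ G small zero    ()
lemma12 r _ G small (suc ℓ) _ with ascend (potential G) (length (edges G) * suc ℓ) (potential≤ G)
                                          (stable-or-improvable G) (λ _ → zero)
... | c , stable = c , stable⇒sameDeg≤ G small c stable
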